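{- Let $x, y$ be positive integers satisfying $5^x + 3 = 2^y$. Then $(x,y) = (1,3)$ or $(x,y) = (3,7)$. -}

module Defs where

-- For y ≥ 8 the equation is refuted modulo 2⁸ · 641: modulo 2⁸ the right side
-- vanishes and 5 has order 64, while 641 divides 2³² + 1, so 2 has order 64
-- modulo 641.  Both sides thus depend only on x and y modulo 64, and the
-- remaining 64 × 64 cases are checked by computation.  For y < 8 we have
-- 5ˣ < 2⁸ < 5⁴, which leaves finitely many pairs; among them (0, 2) is the
-- one excluded by the hypothesis 0 < x.
module Submission where

open import Defs
open import Data.Nat using (ℕ; _+_; _^_; _<_)
open import Data.Product using (_×_)
open import Data.Sum using (_⊎_)
open import Relation.Binary.PropositionalEquality using (_≡_)

open import Data.Nat using (zero; suc; _*_; _%_; _/_; _≟_; _<?_; s≤s; z≤n; NonZero; allUpTo?)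
open import Data.Nat.Properties
open import Data.Nat.DivMod using (%-distribˡ-*; %-distribˡ-+; m≡m%n+[m/n]*n; m%n<n)
open import Data.Empty using (⊥-elim)
open import Data.Product using (_,_)
open import Relation.Nullary using (yes; no)
open import Relation.Nullary.Decidable using (from-yes; ¬?; _×-dec_; _⊎-dec_; _→-dec_)
open import Relation.Binary.PropositionalEquality
  using (_≢_; refl; sym; trans; cong; module ≡-Reasoning)

%-*-congʳ : ∀ c {a b} m .{{_ : NonZero m}} →
            a % m ≡ b % m → (c * a) % m ≡ (c * b) % m
%-*-congʳ c {a} {b} m a≡b = begin
  (c * a) % m              ≡⟨ %-distribˡ-* c a m ⟩
  (c % m * (a % m)) % m    ≡⟨ cong (λ r → (c % m * r) % m) a≡b ⟩
  (c % m * (b % m)) % m    ≡⟨ %-distribˡ-* c b m ⟨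
  (c * b) % m              ∎
  where open ≡-Reasoning

%-+-congˡ : ∀ a b c m .{{_ : NonZero m}} →
            a % m ≡ b % m → (a + c) % m ≡ (b + c) % m
%-+-congˡ a b c m a≡b = begin
  (a + c) % m              ≡⟨ %-distribˡ-+ a c m ⟩
  (a % m + c % m) % m      ≡⟨ cong (λ r → (r + c % m) % m) a≡b ⟩
  (b % m + c % m) % m      ≡⟨ %-distribˡ-+ b c m ⟨
  (b + c) % m              ∎
  where open ≡-Reasoning

module _ (a k p m : ℕ) .{{_ : NonZero p}} .{{_ : NonZero m}}
         (period : a ^ (k + p) % m ≡ a ^ k % m) where

  open ≡-Reasoning

  ^-%-shift : ∀ n → a ^ (k + p + n) % m ≡ a ^ (k + n) % m
  ^-%-shift n = begin
    a ^ (k + p + n) % m      ≡⟨ cong (_% m) (^-distribˡ-+-* a (k + p) n) ⟩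
    a ^ (k + p) * a ^ n % m  ≡⟨ cong (_% m) (*-comm (a ^ (k + p)) (a ^ n)) ⟩
    a ^ n * a ^ (k + p) % m  ≡⟨ %-*-congʳ (a ^ n) m period ⟩
    a ^ n * a ^ k % m        ≡⟨ cong (_% m) (*-comm (a ^ n) (a ^ k)) ⟩
    a ^ k * a ^ n % m        ≡⟨ cong (_% m) (^-distribˡ-+-* a k n) ⟨
    a ^ (k + n) % m          ∎

  ^-%-shift-multiple : ∀ q r → a ^ (k + (q * p + r)) % m ≡ a ^ (k + r) % m
  ^-%-shift-multiple zero    r = refl
  ^-%-shift-multiple (suc q) r = begin
    a ^ (k + (p + q * p + r)) % m  ≡⟨ cong (λ e → a ^ e % m) (reassoc k p (q * p) r) ⟩
    a ^ (k + p + (q * p + r)) % m  ≡⟨ ^-%-shift (q * p + r) ⟩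
    a ^ (k + (q * p + r)) % m      ≡⟨ ^-%-shift-multiple q r ⟩
    a ^ (k + r) % m                ∎
    where
    reassoc : ∀ w x y z → w + (x + y + z) ≡ w + x + (y + z)
    reassoc w x y z = trans (cong (w +_) (+-assoc x y z)) (sym (+-assoc w x (y + z)))

  ^-%-periodic : ∀ n → a ^ (k + n) % m ≡ a ^ (k + n % p) % m
  ^-%-periodic n = begin
    a ^ (k + n) % m                        ≡⟨ cong (λ e → a ^ (k + e) % m) n≡qp+r ⟩
    a ^ (k + (n / p * p + n % p)) % m      ≡⟨ ^-%-shift-multiple (n / p) (n % p) ⟩
    a ^ (k + n % p) % m                    ∎
    where
    n≡qp+r : n ≡ n / p * p + n % p
    n≡qp+r = trans (m≡m%n+[m/n]*n n p) (+-comm (n % p) (n / p * p))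

modulus : ℕ
modulus = 2 ^ 8 * 641

5^x-%-periodic : ∀ x → 5 ^ x % modulus ≡ 5 ^ (x % 64) % modulus
5^x-%-periodic = ^-%-periodic 5 0 64 modulus refl

2^8+t-%-periodic : ∀ t → 2 ^ (8 + t) % modulus ≡ 2 ^ (8 + t % 64) % modulus
2^8+t-%-periodic = ^-%-periodic 2 8 64 modulus refl

no-solution-mod-modulus : ∀ {a b} → a < 64 → b < 64 →
                          (5 ^ a + 3) % modulus ≢ 2 ^ (8 + b) % modulus
no-solution-mod-modulus a<64 b<64 = from-yes
  (allUpTo? (λ a → allUpTo? (λ b → ¬? ((5 ^ a + 3) % modulus ≟ 2 ^ (8 + b) % modulus)) 64) 64)
  a<64 b<64

no-solution-8≤y : ∀ x t → 5 ^ x + 3 ≢ 2 ^ (8 + t)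
no-solution-8≤y x t eq = no-solution-mod-modulus (m%n<n x 64) (m%n<n t 64) (begin
  (5 ^ (x % 64) + 3) % modulus  ≡⟨ %-+-congˡ (5 ^ x) (5 ^ (x % 64)) 3 modulus (5^x-%-periodic x) ⟨
  (5 ^ x + 3) % modulus         ≡⟨ cong (_% modulus) eq ⟩
  2 ^ (8 + t) % modulus         ≡⟨ 2^8+t-%-periodic t ⟩
  2 ^ (8 + t % 64) % modulus    ∎)
  where open ≡-Reasoning

x<4-if-y<8 : ∀ {x y} → y < 8 → 5 ^ x + 3 ≡ 2 ^ y → x < 4
x<4-if-y<8 {x} {y} y<8 eq = ≰⇒> λ 4≤x → <-irrefl refl (begin-strict
  5 ^ 4        ≤⟨ ^-monoʳ-≤ 5 4≤x ⟩
  5 ^ x        ≤⟨ m≤m+n (5 ^ x) 3 ⟩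
  5 ^ x + 3    ≡⟨ eq ⟩
  2 ^ y        <⟨ ^-monoʳ-< 2 (s≤s (s≤s z≤n)) y<8 ⟩
  2 ^ 8        <⟨ from-yes (2 ^ 8 <? 5 ^ 4) ⟩
  5 ^ 4        ∎)
  where open ≤-Reasoning

small-solutions : ∀ {x y} → x < 4 → y < 8 → 0 < x → 5 ^ x + 3 ≡ 2 ^ y →
                  (x ≡ 1 × y ≡ 3) ⊎ (x ≡ 3 × y ≡ 7)
small-solutions x<4 y<8 = from-yes (allUpTo? (λ x → allUpTo? (λ y →
  (0 <? x) →-dec ((5 ^ x + 3 ≟ 2 ^ y) →-dec
    (((x ≟ 1) ×-dec (y ≟ 3)) ⊎-dec ((x ≟ 3) ×-dec (y ≟ 7))))) 8) 4)
  x<4 y<8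

mainTheorem1 : (x y : ℕ) → 0 < x → 0 < y → 5 ^ x + 3 ≡ 2 ^ y →
    (x ≡ 1 × y ≡ 3) ⊎ (x ≡ 3 × y ≡ 7)
mainTheorem1 x y 0<x _ eq with y <? 8
... | yes y<8 = small-solutions (x<4-if-y<8 y<8 eq) y<8 0<x eq
... | no  y≮8 with m≤n⇒∃[o]m+o≡n (≮⇒≥ y≮8)
...   | t , refl = ⊥-elim (no-solution-8≤y x t eq)
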